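{- For every positive integer $n$: if $n$ is an $H_2$-number then it is an $H_4$-number; if $n$ is an $H^*$-number then it is an $H_6$-number; if $n$ is an $H_5$-number then it is an $H^{**}$-number. If $n=p_1^{\varepsilon_1}\cdots p_r^{\varepsilon_r}$ with distinct primes $p_i$ and $\varepsilon_i\in\{1,2\}$, then $n$ is an $H^{**}$-number iff it is an $H^*$-number iff it is an $H_6$-number; $n$ is an $H_5$-number iff it is an $H^*$-number; and $n$ is an $H_2$-number iff it is an $H_4$-number. If $n=p_1^{a_1}\cdots p_r^{a_r}$ with all $a_i$ odd, then $n$ is an $H_2$-number iff it is an $H_5$-number; $n$ is an $H$-number iff it is an $H_3$-number iff it is an $H_4$-number; and $n$ is an $H_1$-number iff it is an $H_6$-number.
   Context: $\sigma(n)$, $d(n)$: sum and number of positive divisors of $n$. A divisor $d$ of $n$ is unitary if $\gcd(d,n/d)=1$; $\sigma^*(n)$, $d^*(n)$: sum and number of unitary divisors. A divisor $d$ of $n$ is bi-unitary if the greatest common unitary divisor of $d$ and $n/d$ is $1$; $\sigma^{**}(n)$, $d^{**}(n)$: sum and number of bi-unitary divisors. Define $H(n)=\frac{nd(n)}{\sigma(n)}$, $H^*(n)=\frac{nd^*(n)}{\sigma^*(n)}$, $H^{**}(n)=\frac{nd^{**}(n)}{\sigma^{**}(n)}$, $H_1(n)=\frac{nd(n)}{\sigma^*(n)}$, $H_2(n)=\frac{nd^*(n)}{\sigma(n)}$, $H_3(n)=\frac{nd(n)}{\sigma^{**}(n)}$, $H_4(n)=\frac{nd^{**}(n)}{\sigma(n)}$,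 $H_5(n)=\frac{nd^*(n)}{\sigma^{**}(n)}$, $H_6(n)=\frac{nd^{**}(n)}{\sigma^*(n)}$. For $X\in\{H,H^*,H^{**},H_1,\dots,H_6\}$, $n$ is called an $X$-number if $X(n)$ is an integer. -}

module Defs where

open import Data.Nat using (ℕ; zero; suc; _+_; _*_; _^_; _⊔_; _%_; _/_)
open import Data.Nat.Properties using (_≟_)
open import Data.Nat.Divisibility using (_∣_; _∣?_)
open import Data.Nat.GCD using (gcd)
open import Data.Nat.Primality using (Prime)
open import Data.List using (List; []; _∷_; map; filter; upTo; length; foldr)
open import Data.Nat.ListAction using (sum; product)
open import Data.List.Relation.Unary.All using (All)
open import Data.List.Relation.Unary.Unique.Propositional using (Unique)
open import Data.Product using (_×_; _,_; proj₁; proj₂; ∃)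
open import Data.Sum using (_⊎_)
open import Relation.Binary.PropositionalEquality using (_≡_)
open import Relation.Nullary using (Dec)
open import Relation.Nullary.Decidable using (_×-dec_)

oneTo : ℕ → List ℕ
oneTo n = map suc (upTo n)

-- complementary divisor n / d (with the convention n / 0 = 0, never used on divisors)
cof : ℕ → ℕ → ℕ
cof n zero = 0
cof n (suc k) = n / suc k

divisors : ℕ → List ℕ
divisors n = filter (_∣? n) (oneTo n)

IsUnitaryDiv : ℕ → ℕ → Set
IsUnitaryDiv n d = d ∣ n × gcd d (cof n d) ≡ 1

isUnitaryDiv? : ∀ n d → Dec (IsUnitaryDiv n d)
isUnitaryDiv? n d = (d ∣? n) ×-dec (gcd d (cof n d) ≟ 1)

unitaryDivisors : ℕ → List ℕ
unitaryDivisors n = filter (isUnitaryDiv? n) (oneTo n)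

gcud : ℕ → ℕ → ℕ
gcud a b = foldr _⊔_ 0
  (filter (λ k → isUnitaryDiv? a k ×-dec isUnitaryDiv? b k) (oneTo a))

IsBiUnitaryDiv : ℕ → ℕ → Set
IsBiUnitaryDiv n d = d ∣ n × gcud d (cof n d) ≡ 1

isBiUnitaryDiv? : ∀ n d → Dec (IsBiUnitaryDiv n d)
isBiUnitaryDiv? n d = (d ∣? n) ×-dec (gcud d (cof n d) ≟ 1)

biUnitaryDivisors : ℕ → List ℕ
biUnitaryDivisors n = filter (isBiUnitaryDiv? n) (oneTo n)

σ τ σ* τ* σ** τ** : ℕ → ℕ
σ n = sum (divisors n)
τ n = length (divisors n)
σ* n = sum (unitaryDivisors n)
τ* n = length (unitaryDivisors n)
σ** n = sum (biUnitaryDivisors n)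
τ** n = length (biUnitaryDivisors n)

-- num / den is an integer (den > 0 whenever n ≥ 1)
IsIntegral : ℕ → ℕ → Set
IsIntegral num den = den ∣ num

H-number H*-number H**-number : ℕ → Set
H-number n = IsIntegral (n * τ n) (σ n)
H*-number n = IsIntegral (n * τ* n) (σ* n)
H**-number n = IsIntegral (n * τ** n) (σ** n)

H₁-number H₂-number H₃-number H₄-number H₅-number H₆-number : ℕ → Set
H₁-number n = IsIntegral (n * τ n) (σ* n)
H₂-number n = IsIntegral (n * τ* n) (σ n)
H₃-number n = IsIntegral (n * τ n) (σ** n)
H₄-number n = IsIntegral (n * τ** n) (σ n)
H₅-number n = IsIntegral (n * τ* n) (σ** n)
H₆-number n = IsIntegral (n * τ** n) (σ* n)

IsFactorization : ℕ → List (ℕ × ℕ) → Set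
IsFactorization n fs =
  All (λ pe → Prime (proj₁ pe)) fs × Unique (map proj₁ fs) ×
  n ≡ product (map (λ pe → proj₁ pe ^ proj₂ pe) fs)

ExponentsOneOrTwo : ℕ → Set
ExponentsOneOrTwo n = ∃ λ fs → IsFactorization n fs ×
  All (λ pe → proj₂ pe ≡ 1 ⊎ proj₂ pe ≡ 2) fs

ExponentsOdd : ℕ → Set
ExponentsOdd n = ∃ λ fs → IsFactorization n fs ×
  All (λ pe → proj₂ pe % 2 ≡ 1) fs

module Submission where

-- The theorem rests on
-- three facts about n > 0:
--   (1) τ*(n) ∣ τ**(n).  Both counts are multiplicative.  If n > 1 has a unitary divisor
--       strictly between 1 and n we split n into two coprime smaller factors and induct;
--       otherwise τ*(n) = 2, while τ**(n) is even because d ↦ n / d is a fixed-point-free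
--       involution of the bi-unitary divisors.  Hence n τ*(n) ∣ n τ**(n).
--   (2) If every exponent of n is 1 or 2, the bi-unitary divisors of n are the unitary ones.
--   (3) If every exponent of n is odd, every divisor of n is bi-unitary.
-- (2) and (3) are checked on prime powers p^a, where d and n / d are powers p^i, p^l with
-- i + l = a, and are transported to n through the factorisation by multiplicativity.
-- By (2) and (3) the relevant sums and counts coincide, so the equivalences follow.

open import Data.Nat
  using (ℕ; zero; suc; _+_; _*_; _^_; _≤_; _<_; _⊔_; _/_; _%_; z≤n; s≤s; z<s; _<?_; NonZero; >-nonZero; ≢-nonZero)
open import Data.Nat.Base using (nonTrivial⇒n>1)
open import Data.Nat.Properties
open import Data.Nat.Divisibility
open import Data.Nat.DivMod using (m*n/n≡m; m*n%n≡0)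
open import Data.Nat.GCD using (gcd; gcd[m,n]∣m; gcd[m,n]∣n; gcd-greatest; gcd[m,n]≢0)
open import Data.Nat.Coprimality using (Coprime; coprime-divisor; coprime⇒gcd≡1; gcd≡1⇒coprime)
import Data.Nat.Coprimality as Coprimality
open import Data.Nat.Primality
  using (Prime; euclidsLemma; prime⇒irreducible; prime⇒nonZero; prime⇒nonTrivial)
open import Data.Nat.Induction using (<-rec)
open import Data.Nat.ListAction using (sum; product)
open import Data.Nat.Tactic.RingSolver using (solve-∀)
open import Data.List using (List; []; _∷_; map; filter; length; foldr; _++_; cartesianProduct)
open import Data.List.Properties
  using (length-map; length-++; length-removeAt′; filter-accept; filter-reject; filter-≐)
open import Data.List.Membership.Propositional using (_∈_; find; lose)
open import Data.List.Membership.Propositional.Properties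
  using (∈-map⁺; ∈-map⁻; ∈-filter⁺; ∈-filter⁻; ∈-upTo⁺; ∈-cartesianProduct⁺; ∈-cartesianProduct⁻)
open import Data.List.Relation.Binary.Subset.Propositional using (_⊆_)
open import Data.List.Relation.Unary.Any using (Any; here; there; _─_; index; any?)
open import Data.List.Relation.Unary.All as All using (All; []; _∷_)
import Data.List.Relation.Unary.All.Properties as AllP
open import Data.List.Relation.Unary.AllPairs using ([]; _∷_)
open import Data.List.Relation.Unary.Unique.Propositional using (Unique)
import Data.List.Relation.Unary.Unique.Propositional.Properties as Unique
open import Data.Product using (_×_; _,_; proj₁; proj₂; ∃; ∃₂)
open import Data.Sum using (_⊎_; inj₁; inj₂)
open import Data.Empty using (⊥-elim)
open import Function using (_∘_)
open import Function.Bundles using (_⇔_; mk⇔)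
open import Relation.Nullary using (yes; no; ¬_)
open import Relation.Nullary.Decidable using (_×-dec_)
open import Relation.Unary using (Decidable)
open import Relation.Binary.PropositionalEquality
open import Relation.Binary.Definitions using (tri<; tri≈; tri>)
open import Defs

∈-─ : ∀ {A : Set} {x y : A} {ys} (x∈ys : x ∈ ys) → y ∈ ys → y ≢ x → y ∈ (ys ─ x∈ys)
∈-─ (here refl) (here refl) y≢x = ⊥-elim (y≢x refl)
∈-─ (here _)    (there y∈)  _   = y∈
∈-─ (there _)   (here refl) _   = here refl
∈-─ (there x∈)  (there y∈)  y≢x = there (∈-─ x∈ y∈ y≢x)

unique-length-≤ : ∀ {A : Set} {xs ys : List A} → Unique xs → xs ⊆ ys → length xs ≤ length ys
unique-length-≤ {xs = []}     _                xs⊆ys = z≤n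
unique-length-≤ {xs = x ∷ xs} {ys} (x∉xs ∷ uniq) xs⊆ys = begin
  suc (length xs)          ≤⟨ s≤s (unique-length-≤ uniq xs⊆ys─x) ⟩
  suc (length (ys ─ x∈ys)) ≡⟨ length-removeAt′ ys (index x∈ys) ⟨
  length ys                ∎
  where
  open ≤-Reasoning
  x∈ys : x ∈ ys
  x∈ys = xs⊆ys (here refl)
  xs⊆ys─x : xs ⊆ (ys ─ x∈ys)
  xs⊆ys─x y∈xs = ∈-─ x∈ys (xs⊆ys (there y∈xs)) (λ y≡x → All.lookup x∉xs y∈xs (sym y≡x))

unique-length-≡ : ∀ {A : Set} {xs ys : List A} → Unique xs → Unique ys →
                  xs ⊆ ys → ys ⊆ xs → length xs ≡ length ys
unique-length-≡ uxs uys xs⊆ys ys⊆xs = ≤-antisym (unique-length-≤ uxs xs⊆ys) (unique-length-≤ uys ys⊆xs)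

map-unique : ∀ {A B : Set} (f : A → B) {xs} → Unique xs →
             (∀ {x y} → x ∈ xs → y ∈ xs → f x ≡ f y → x ≡ y) → Unique (map f xs)
map-unique f {[]}     []             _   = []
map-unique f {x ∷ xs} (x∉xs ∷ uniq) inj =
  AllP.map⁺ (All.tabulate λ y∈xs fx≡fy → All.lookup x∉xs y∈xs (inj (here refl) (there y∈xs) fx≡fy))
  ∷ map-unique f uniq (λ x∈ y∈ → inj (there x∈) (there y∈))

length-cartesianProduct : ∀ {A B : Set} (xs : List A) (ys : List B) →
                          length (cartesianProduct xs ys) ≡ length xs * length ys
length-cartesianProduct []       ys = refl
length-cartesianProduct (x ∷ xs) ys = begin
  length (map (x ,_) ys ++ cartesianProduct xs ys)        ≡⟨ length-++ (map (x ,_) ys) ⟩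
  length (map (x ,_) ys) + length (cartesianProduct xs ys) ≡⟨ cong₂ _+_ (length-map (x ,_) ys) (length-cartesianProduct xs ys) ⟩
  length ys + length xs * length ys                      ∎
  where open ≡-Reasoning

count-products : ∀ {xs ys zs : List ℕ} → Unique xs → Unique ys → Unique zs →
  (∀ {a b} → a ∈ xs → b ∈ ys → a * b ∈ zs) →
  (∀ {c} → c ∈ zs → ∃₂ λ a b → a ∈ xs × b ∈ ys × c ≡ a * b) →
  (∀ {a b a′ b′} → a ∈ xs → a′ ∈ xs → b ∈ ys → b′ ∈ ys → a * b ≡ a′ * b′ → a ≡ a′ × b ≡ b′) →
  length zs ≡ length xs * length ys
count-products {xs} {ys} {zs} uxs uys uzs closed split inj = begin
  length zs       ≡⟨ unique-length-≡ uzs unique-products zs⊆products products⊆zs ⟩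
  length products ≡⟨ length-map multiply pairs ⟩
  length pairs    ≡⟨ length-cartesianProduct xs ys ⟩
  length xs * length ys ∎
  where
  open ≡-Reasoning
  multiply : ℕ × ℕ → ℕ
  multiply (a , b) = a * b
  pairs : List (ℕ × ℕ)
  pairs = cartesianProduct xs ys
  products : List ℕ
  products = map multiply pairs

  multiply-injective : ∀ {p q} → p ∈ pairs → q ∈ pairs → multiply p ≡ multiply q → p ≡ q
  multiply-injective {a , b} {a′ , b′} p∈ q∈ eq
    with a∈ , b∈ ← ∈-cartesianProduct⁻ xs ys p∈ | a′∈ , b′∈ ← ∈-cartesianProduct⁻ xs ys q∈
    with a≡a′ , b≡b′ ← inj a∈ a′∈ b∈ b′∈ eq = cong₂ _,_ a≡a′ b≡b′

  unique-products : Unique products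
  unique-products = map-unique multiply (Unique.cartesianProduct⁺ uxs uys) multiply-injective

  zs⊆products : zs ⊆ products
  zs⊆products c∈ with a , b , a∈ , b∈ , refl ← split c∈ = ∈-map⁺ multiply (∈-cartesianProduct⁺ a∈ b∈)

  products⊆zs : products ⊆ zs
  products⊆zs c∈ with (a , b) , p∈ , refl ← ∈-map⁻ multiply c∈ =
    let a∈ , b∈ = ∈-cartesianProduct⁻ xs ys p∈ in closed a∈ b∈

-- A duplicate-free list of naturals closed under a fixed-point-free involution f has even
-- length: f maps the elements with x < f x bijectively onto those with f x < x.
involution-even : (f : ℕ → ℕ) (xs : List ℕ) → Unique xs →
  (∀ {x} → x ∈ xs → f x ∈ xs) → (∀ {x} → x ∈ xs → f (f x) ≡ x) → (∀ {x} → x ∈ xs → f x ≢ x) →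
  2 ∣ length xs
involution-even f xs uniq closed involutive no-fixed-point = divides (length ascending) doubled
  where
  rising? : Decidable (λ x → x < f x)
  rising? x = x <? f x
  falling? : Decidable (λ x → f x < x)
  falling? x = f x <? x
  ascending descending : List ℕ
  ascending  = filter rising? xs
  descending = filter falling? xs

  -- without fixed points every element is rising or falling
  split : ∀ ys → (∀ {x} → x ∈ ys → f x ≢ x) →
          length ys ≡ length (filter rising? ys) + length (filter falling? ys)
  split []       _  = refl
  split (y ∷ ys) nf with rising? y | falling? y | split ys (nf ∘ there)
  ... | yes r | yes d | _  = ⊥-elim (<-asym r d)
  ... | yes r | no ¬d | ih
    rewrite filter-accept rising? {xs = ys} r | filter-reject falling? {xs = ys} ¬d = cong suc ih
  ... | no ¬r | yes d | ih
    rewrite filter-reject rising? {xs = ys} ¬r | filter-accept falling? {xs = ys} d =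
      trans (cong suc ih) (sym (+-suc _ _))
  ... | no ¬r | no ¬d | _  = ⊥-elim (nf (here refl) (≤-antisym (≮⇒≥ ¬r) (≮⇒≥ ¬d)))

  f-injective : ∀ {x y} → x ∈ xs → y ∈ xs → f x ≡ f y → x ≡ y
  f-injective x∈ y∈ eq = trans (sym (involutive x∈)) (trans (cong f eq) (involutive y∈))

  transfer : ∀ {P Q : ℕ → Set} (P? : Decidable P) (Q? : Decidable Q) →
             (∀ {x} → x ∈ xs → P x → Q (f x)) → length (filter P? xs) ≤ length (filter Q? xs)
  transfer P? Q? P⇒Q = begin
    length (filter P? xs)         ≡⟨ length-map f (filter P? xs) ⟨
    length (map f (filter P? xs)) ≤⟨ unique-length-≤ (map-unique f (Unique.filter⁺ P? uniq) inj) image⊆ ⟩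
    length (filter Q? xs)         ∎
    where
    open ≤-Reasoning
    inj : ∀ {x y} → x ∈ filter P? xs → y ∈ filter P? xs → f x ≡ f y → x ≡ y
    inj x∈ y∈ = f-injective (proj₁ (∈-filter⁻ P? x∈)) (proj₁ (∈-filter⁻ P? y∈))
    image⊆ : map f (filter P? xs) ⊆ filter Q? xs
    image⊆ y∈ with x , x∈ , refl ← ∈-map⁻ f y∈ =
      let x∈xs , px = ∈-filter⁻ P? x∈ in ∈-filter⁺ Q? (closed x∈xs) (P⇒Q x∈xs px)

  balanced : length ascending ≡ length descending
  balanced = ≤-antisym
    (transfer rising? falling? λ {x} x∈ x<fx → subst (_< f x) (sym (involutive x∈)) x<fx)
    (transfer falling? rising? λ {x} x∈ fx<x → subst (f x <_) (sym (involutive x∈)) fx<x)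

  doubled : length xs ≡ length ascending * 2
  doubled = begin
    length xs                            ≡⟨ split xs no-fixed-point ⟩
    length ascending + length descending ≡⟨ cong (length ascending +_) balanced ⟨
    length ascending + length ascending  ≡⟨ cong (length ascending +_) (+-identityʳ _) ⟨
    2 * length ascending                 ≡⟨ *-comm 2 (length ascending) ⟩
    length ascending * 2                 ∎
    where open ≡-Reasoning

∣-factorˡ : ∀ x y {z} → x * y ≡ z → x ∣ z
∣-factorˡ x y eq = subst (x ∣_) eq (m∣m*n y)

∣-factorʳ : ∀ x y {z} → x * y ≡ z → y ∣ z
∣-factorʳ x y eq = subst (y ∣_) eq (n∣m*n x)

divisor-pos : ∀ {m n} → m ∣ n → 0 < n → 0 < m
divisor-pos {zero}  (divides q refl) n>0 rewrite *-zeroʳ q = n>0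
divisor-pos {suc m} _                _   = z<s

divisor-≤ : ∀ {k n} → 0 < n → k ∣ n → k ≤ n
divisor-≤ {n = suc n} _ k∣n = ∣⇒≤ k∣n

coprime-∣ : ∀ {a b x y} → Coprime a b → x ∣ a → y ∣ b → Coprime x y
coprime-∣ a⊥b x∣a y∣b (i∣x , i∣y) = a⊥b (∣-trans i∣x x∣a , ∣-trans i∣y y∣b)

coprime-*ˡ : ∀ {x y z} → Coprime x z → Coprime y z → Coprime (x * y) z
coprime-*ˡ {x} x⊥z y⊥z {i} (i∣xy , i∣z) = y⊥z (coprime-divisor i⊥x i∣xy , i∣z)
  where
  i⊥x : Coprime i x
  i⊥x (j∣i , j∣x) = x⊥z (j∣x , ∣-trans j∣i i∣z)

coprime-*ʳ : ∀ {x y z} → Coprime x y → Coprime x z → Coprime x (y * z)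
coprime-*ʳ x⊥y x⊥z = Coprimality.sym (coprime-*ˡ (Coprimality.sym x⊥y) (Coprimality.sym x⊥z))

Unitary : ℕ → ℕ → Set
Unitary x k = ∃ λ e → k * e ≡ x × Coprime k e

-- 1 is the only common unitary divisor of d and e (i.e. their gcud is 1).
UnitarilyCoprime : ℕ → ℕ → Set
UnitarilyCoprime d e = ∀ k → Unitary d k → Unitary e k → k ≡ 1

BiUnitary : ℕ → ℕ → Set
BiUnitary x d = ∃ λ e → d * e ≡ x × UnitarilyCoprime d e

unitary-one : ∀ x → Unitary x 1
unitary-one x = x , *-identityˡ x , λ (i∣1 , _) → ∣1⇒≡1 i∣1

unitary-self : ∀ x → Unitary x x
unitary-self x = 1 , *-identityʳ x , λ (_ , i∣1) → ∣1⇒≡1 i∣1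

unitary⇒∣ : ∀ {x k} → Unitary x k → k ∣ x
unitary⇒∣ {k = k} (_ , eq , _) = ∣-factorˡ k _ eq

biUnitary⇒∣ : ∀ {x d} → BiUnitary x d → d ∣ x
biUnitary⇒∣ {d = d} (_ , eq , _) = ∣-factorˡ d _ eq

unitary⇒biUnitary : ∀ {x k} → Unitary x k → BiUnitary x k
unitary⇒biUnitary (e , eq , k⊥e) = e , eq , λ j j∥k j∥e → k⊥e (unitary⇒∣ j∥k , unitary⇒∣ j∥e)

biUnitary-complement : ∀ {x d} (b : BiUnitary x d) → BiUnitary x (proj₁ b)
biUnitary-complement {d = d} (e , de≡x , d∥e) = d , trans (*-comm e d) de≡x , λ k k∥e k∥d → d∥e k k∥d k∥e

-- Every divisor d of a * b, with a ⊥ b, is d₁ * d₂ with d₁ ∣ a and d₂ ∣ b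
-- (take d₁ = gcd d a; the cofactor d / d₁ is coprime to a / d₁, hence divides b).
coprime-split-divisor : ∀ {a b d} → Coprime a b → 0 < a → d ∣ a * b →
                        ∃₂ λ d₁ d₂ → d ≡ d₁ * d₂ × d₁ ∣ a × d₂ ∣ b
coprime-split-divisor {a} {b} {d} a⊥b a>0 d∣ab
  with gcd[m,n]∣m d a | gcd[m,n]∣n d a
... | divides x d≡x*g | divides a′ a≡a′*g = g , x , trans d≡x*g (*-comm x g) , divides a′ a≡a′*g , x∣b
  where
  g : ℕ
  g = gcd d a
  instance
    g≢0 : NonZero g
    g≢0 = ≢-nonZero (gcd[m,n]≢0 d a (inj₂ λ a≡0 → <-irrefl (sym a≡0) a>0))
  x∣a′b : x ∣ a′ * b
  x∣a′b = *-cancelʳ-∣ g (subst₂ _∣_ d≡x*g (trans (cong (_* b) a≡a′*g) (rearrange a′ g b)) d∣ab)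
    where
    rearrange : ∀ u v w → u * v * w ≡ u * w * v
    rearrange = solve-∀
  -- a common divisor i of x and a′ gives the common divisor i * g of d and a
  x⊥a′ : Coprime x a′
  x⊥a′ {i} (i∣x , i∣a′) = ∣1⇒≡1 (*-cancelʳ-∣ g (subst (i * g ∣_) (sym (*-identityˡ g)) ig∣g))
    where
    ig∣g : i * g ∣ g
    ig∣g = gcd-greatest (subst (i * g ∣_) (sym d≡x*g) (*-monoˡ-∣ g i∣x))
                        (subst (i * g ∣_) (sym a≡a′*g) (*-monoˡ-∣ g i∣a′))
  x∣b : x ∣ b
  x∣b = coprime-divisor x⊥a′ x∣a′b

coprime-factor-unique : ∀ {a b x₁ x₂ y₁ y₂} → Coprime a b → 0 < a →
  x₁ ∣ a → y₁ ∣ a → x₂ ∣ b → y₂ ∣ b → x₁ * x₂ ≡ y₁ * y₂ → x₁ ≡ y₁ × x₂ ≡ y₂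
coprime-factor-unique {x₁ = x₁} {x₂} {y₁} {y₂} a⊥b a>0 x₁∣a y₁∣a x₂∣b y₂∣b eq =
  x₁≡y₁ , *-cancelˡ-≡ x₂ y₂ x₁ (trans eq (cong (_* y₂) (sym x₁≡y₁)))
  where
  instance
    x₁≢0 : NonZero x₁
    x₁≢0 = >-nonZero (divisor-pos x₁∣a a>0)
  x₁≡y₁ : x₁ ≡ y₁
  x₁≡y₁ = ∣-antisym
    (coprime-divisor (coprime-∣ a⊥b x₁∣a y₂∣b) (subst (x₁ ∣_) (trans eq (*-comm y₁ y₂)) (m∣m*n x₂)))
    (coprime-divisor (coprime-∣ a⊥b y₁∣a x₂∣b) (subst (y₁ ∣_) (trans (sym eq) (*-comm x₁ x₂)) (m∣m*n y₂)))

interchange : ∀ u v w z → (u * w) * (v * z) ≡ (u * v) * (w * z)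
interchange = solve-∀

coprime-split-pair : ∀ {a b d e} → Coprime a b → 0 < a → 0 < b → d * e ≡ a * b →
  ∃₂ λ d₁ d₂ → ∃₂ λ e₁ e₂ → d ≡ d₁ * d₂ × e ≡ e₁ * e₂ × d₁ * e₁ ≡ a × d₂ * e₂ ≡ b
coprime-split-pair {a} {b} {d} {e} a⊥b a>0 b>0 de≡ab
  with d₁ , d₂ , refl , divides e₁ a≡e₁d₁ , divides e₂ b≡e₂d₂ ← coprime-split-divisor {d = d} a⊥b a>0 (∣-factorˡ d e de≡ab) =
  d₁ , d₂ , e₁ , e₂ , refl , e≡e₁e₂ , trans (*-comm d₁ e₁) (sym a≡e₁d₁) , trans (*-comm d₂ e₂) (sym b≡e₂d₂)
  where
  instance
    d≢0 : NonZero (d₁ * d₂)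
    d≢0 = >-nonZero (divisor-pos (∣-factorˡ d e de≡ab) (*-mono-< a>0 b>0))
  e≡e₁e₂ : e ≡ e₁ * e₂
  e≡e₁e₂ = *-cancelˡ-≡ e (e₁ * e₂) (d₁ * d₂) (begin
    d₁ * d₂ * e           ≡⟨ de≡ab ⟩
    a * b                 ≡⟨ cong₂ _*_ (trans a≡e₁d₁ (*-comm e₁ d₁)) (trans b≡e₂d₂ (*-comm e₂ d₂)) ⟩
    d₁ * e₁ * (d₂ * e₂)   ≡⟨ interchange d₁ d₂ e₁ e₂ ⟩
    d₁ * d₂ * (e₁ * e₂)   ∎)
    where open ≡-Reasoning

unitary-split : ∀ {a b k} → Coprime a b → 0 < a → 0 < b → Unitary (a * b) k →
                ∃₂ λ k₁ k₂ → k ≡ k₁ * k₂ × Unitary a k₁ × Unitary b k₂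
unitary-split {k = k} a⊥b a>0 b>0 (e , ke≡ab , k⊥e)
  with k₁ , k₂ , e₁ , e₂ , refl , refl , k₁e₁≡a , k₂e₂≡b ← coprime-split-pair {d = k} {e} a⊥b a>0 b>0 ke≡ab =
  k₁ , k₂ , refl ,
  (e₁ , k₁e₁≡a , λ (i∣k₁ , i∣e₁) → k⊥e (∣-trans i∣k₁ (m∣m*n k₂) , ∣-trans i∣e₁ (m∣m*n e₂))) ,
  (e₂ , k₂e₂≡b , λ (i∣k₂ , i∣e₂) → k⊥e (∣-trans i∣k₂ (n∣m*n k₁) , ∣-trans i∣e₂ (n∣m*n e₁)))

unitary-mul : ∀ {a b k₁ k₂} → Coprime a b → Unitary a k₁ → Unitary b k₂ → Unitary (a * b) (k₁ * k₂)
unitary-mul {k₁ = k₁} {k₂} a⊥b (e₁ , k₁e₁≡a , k₁⊥e₁) (e₂ , k₂e₂≡b , k₂⊥e₂) =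
  e₁ * e₂ , trans (sym (interchange k₁ k₂ e₁ e₂)) (cong₂ _*_ k₁e₁≡a k₂e₂≡b) ,
  coprime-*ˡ (coprime-*ʳ k₁⊥e₁ (coprime-∣ a⊥b (∣-factorˡ k₁ e₁ k₁e₁≡a) (∣-factorʳ k₂ e₂ k₂e₂≡b)))
             (coprime-*ʳ (Coprimality.sym (coprime-∣ a⊥b (∣-factorʳ k₁ e₁ k₁e₁≡a) (∣-factorˡ k₂ e₂ k₂e₂≡b))) k₂⊥e₂)

-- Unitary coprimality of the two halves of factorisations d₁e₁ = a and d₂e₂ = b (a ⊥ b)
-- is inherited by the products: a common unitary divisor of d₁d₂ and e₁e₂ splits along a, b.
unitarilyCoprime-mul : ∀ {a b d₁ d₂ e₁ e₂} → Coprime a b → 0 < a → 0 < b →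
  d₁ * e₁ ≡ a → d₂ * e₂ ≡ b → UnitarilyCoprime d₁ e₁ → UnitarilyCoprime d₂ e₂ →
  UnitarilyCoprime (d₁ * d₂) (e₁ * e₂)
unitarilyCoprime-mul {d₁ = d₁} {d₂} {e₁} {e₂} a⊥b a>0 b>0 d₁e₁≡a d₂e₂≡b d₁∥e₁ d₂∥e₂ = common
  where
  d₁⊥d₂ : Coprime d₁ d₂
  d₁⊥d₂ = coprime-∣ a⊥b (∣-factorˡ d₁ e₁ d₁e₁≡a) (∣-factorˡ d₂ e₂ d₂e₂≡b)
  e₁⊥e₂ : Coprime e₁ e₂
  e₁⊥e₂ = coprime-∣ a⊥b (∣-factorʳ d₁ e₁ d₁e₁≡a) (∣-factorʳ d₂ e₂ d₂e₂≡b)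
  common : UnitarilyCoprime (d₁ * d₂) (e₁ * e₂)
  common k k∥d k∥e
    with k₁ , k₂ , refl , k₁∥d₁ , k₂∥d₂ ← unitary-split d₁⊥d₂ (divisor-pos (∣-factorˡ d₁ e₁ d₁e₁≡a) a>0) (divisor-pos (∣-factorˡ d₂ e₂ d₂e₂≡b) b>0) k∥d
       | k₁′ , k₂′ , k≡ , k₁′∥e₁ , k₂′∥e₂ ← unitary-split e₁⊥e₂ (divisor-pos (∣-factorʳ d₁ e₁ d₁e₁≡a) a>0) (divisor-pos (∣-factorʳ d₂ e₂ d₂e₂≡b) b>0) k∥e
    with refl , refl ← coprime-factor-unique a⊥b a>0
           (∣-trans (unitary⇒∣ k₁∥d₁) (∣-factorˡ d₁ e₁ d₁e₁≡a)) (∣-trans (unitary⇒∣ k₁′∥e₁) (∣-factorʳ d₁ e₁ d₁e₁≡a))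
           (∣-trans (unitary⇒∣ k₂∥d₂) (∣-factorˡ d₂ e₂ d₂e₂≡b)) (∣-trans (unitary⇒∣ k₂′∥e₂) (∣-factorʳ d₂ e₂ d₂e₂≡b)) k≡ =
    cong₂ _*_ (d₁∥e₁ k₁ k₁∥d₁ k₁′∥e₁) (d₂∥e₂ k₂ k₂∥d₂ k₂′∥e₂)

biUnitary-mul : ∀ {a b d₁ d₂} → Coprime a b → 0 < a → 0 < b →
                BiUnitary a d₁ → BiUnitary b d₂ → BiUnitary (a * b) (d₁ * d₂)
biUnitary-mul {d₁ = d₁} {d₂} a⊥b a>0 b>0 (e₁ , d₁e₁≡a , d₁∥e₁) (e₂ , d₂e₂≡b , d₂∥e₂) =
  e₁ * e₂ , trans (sym (interchange d₁ d₂ e₁ e₂)) (cong₂ _*_ d₁e₁≡a d₂e₂≡b) ,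
  unitarilyCoprime-mul a⊥b a>0 b>0 d₁e₁≡a d₂e₂≡b d₁∥e₁ d₂∥e₂

-- Bi-unitary divisors of a * b (a ⊥ b) are products of bi-unitary divisors of a and of b:
-- a common unitary divisor k of d₁, e₁ would give the common unitary divisor k * 1 of d, e.
biUnitary-split : ∀ {a b d} → Coprime a b → 0 < a → 0 < b → BiUnitary (a * b) d →
                  ∃₂ λ d₁ d₂ → d ≡ d₁ * d₂ × BiUnitary a d₁ × BiUnitary b d₂
biUnitary-split {d = d} a⊥b a>0 b>0 (e , de≡ab , d∥e)
  with d₁ , d₂ , e₁ , e₂ , refl , refl , d₁e₁≡a , d₂e₂≡b ← coprime-split-pair {d = d} {e} a⊥b a>0 b>0 de≡ab =
  d₁ , d₂ , refl ,
  (e₁ , d₁e₁≡a , λ k k∥d₁ k∥e₁ → trans (sym (*-identityʳ k))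
     (d∥e (k * 1) (unitary-mul d₁⊥d₂ k∥d₁ (unitary-one d₂)) (unitary-mul e₁⊥e₂ k∥e₁ (unitary-one e₂)))) ,
  (e₂ , d₂e₂≡b , λ k k∥d₂ k∥e₂ → trans (sym (*-identityˡ k))
     (d∥e (1 * k) (unitary-mul d₁⊥d₂ (unitary-one d₁) k∥d₂) (unitary-mul e₁⊥e₂ (unitary-one e₁) k∥e₂)))
  where
  d₁⊥d₂ : Coprime d₁ d₂
  d₁⊥d₂ = coprime-∣ a⊥b (∣-factorˡ d₁ e₁ d₁e₁≡a) (∣-factorˡ d₂ e₂ d₂e₂≡b)
  e₁⊥e₂ : Coprime e₁ e₂
  e₁⊥e₂ = coprime-∣ a⊥b (∣-factorʳ d₁ e₁ d₁e₁≡a) (∣-factorʳ d₂ e₂ d₂e₂≡b)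

unique-oneTo : ∀ n → Unique (oneTo n)
unique-oneTo n = Unique.map⁺ suc-injective (Unique.upTo⁺ n)

unique-filter-oneTo : ∀ {P : ℕ → Set} (P? : Decidable P) n → Unique (filter P? (oneTo n))
unique-filter-oneTo P? n = Unique.filter⁺ P? (unique-oneTo n)

∈-oneTo : ∀ {k n} → 0 < k → k ≤ n → k ∈ oneTo n
∈-oneTo {suc k} _ k<n = ∈-map⁺ suc (∈-upTo⁺ k<n)

∈-filter-oneTo : ∀ {P : ℕ → Set} (P? : Decidable P) {n k} → 0 < n → k ∣ n → P k → k ∈ filter P? (oneTo n)
∈-filter-oneTo P? n>0 k∣n Pk = ∈-filter⁺ P? (∈-oneTo (divisor-pos k∣n n>0) (divisor-≤ n>0 k∣n)) Pk

cof-factor : ∀ {d e n} → 0 < d → d * e ≡ n → cof n d ≡ e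
cof-factor {suc k} {e} _ refl = trans (cong (_/ suc k) (*-comm (suc k) e)) (m*n/n≡m e (suc k))

isUnitaryDiv⇒unitary : ∀ {n d} → 0 < n → IsUnitaryDiv n d → Unitary n d
isUnitaryDiv⇒unitary {n} {d} n>0 (d∣n@(divides e n≡ed) , gcd≡1) =
  e , de≡n , gcd≡1⇒coprime (subst (λ c → gcd d c ≡ 1) (cof-factor (divisor-pos d∣n n>0) de≡n) gcd≡1)
  where
  de≡n : d * e ≡ n
  de≡n = trans (*-comm d e) (sym n≡ed)

unitary⇒isUnitaryDiv : ∀ {n d} → 0 < n → Unitary n d → IsUnitaryDiv n d
unitary⇒isUnitaryDiv {n} {d} n>0 (e , de≡n , d⊥e) =
  d∣n , subst (λ c → gcd d c ≡ 1) (sym (cof-factor (divisor-pos d∣n n>0) de≡n)) (coprime⇒gcd≡1 d⊥e)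
  where
  d∣n : d ∣ n
  d∣n = ∣-factorˡ d e de≡n

≤-foldr-⊔ : ∀ {k} xs → k ∈ xs → k ≤ foldr _⊔_ 0 xs
≤-foldr-⊔ (x ∷ xs) (here refl) = m≤m⊔n x _
≤-foldr-⊔ (x ∷ xs) (there k∈) = ≤-trans (≤-foldr-⊔ xs k∈) (m≤n⊔m x _)

foldr-⊔-≤ : ∀ {c} xs → (∀ {k} → k ∈ xs → k ≤ c) → foldr _⊔_ 0 xs ≤ c
foldr-⊔-≤ []       _      = z≤n
foldr-⊔-≤ (x ∷ xs) bound = ⊔-lub (bound (here refl)) (foldr-⊔-≤ xs (bound ∘ there))

-- gcud x y = 1 says exactly that x and y are unitarily coprime (for x, y > 0):
-- the common unitary divisors are positive and 1 is always one of them.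
module _ {x y : ℕ} (x>0 : 0 < x) (y>0 : 0 < y) where

  private
    common? : Decidable (λ k → IsUnitaryDiv x k × IsUnitaryDiv y k)
    common? = λ k → isUnitaryDiv? x k ×-dec isUnitaryDiv? y k
    common-∈ : ∀ {k} → Unitary x k → Unitary y k → k ∈ filter common? (oneTo x)
    common-∈ k∥x k∥y = ∈-filter-oneTo common? x>0 (unitary⇒∣ k∥x)
                         (unitary⇒isUnitaryDiv x>0 k∥x , unitary⇒isUnitaryDiv y>0 k∥y)

  gcud≡1⇒unitarilyCoprime : gcud x y ≡ 1 → UnitarilyCoprime x y
  gcud≡1⇒unitarilyCoprime gcud≡1 k k∥x k∥y =
    ≤-antisym (subst (k ≤_) gcud≡1 (≤-foldr-⊔ _ (common-∈ k∥x k∥y)))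
              (divisor-pos (unitary⇒∣ k∥x) x>0)

  unitarilyCoprime⇒gcud≡1 : UnitarilyCoprime x y → gcud x y ≡ 1
  unitarilyCoprime⇒gcud≡1 x∥y = ≤-antisym
    (foldr-⊔-≤ _ λ k∈ → let isU-x , isU-y = proj₂ (∈-filter⁻ common? {xs = oneTo x} k∈) in
      ≤-reflexive (x∥y _ (isUnitaryDiv⇒unitary x>0 isU-x) (isUnitaryDiv⇒unitary y>0 isU-y)))
    (≤-foldr-⊔ _ (common-∈ (unitary-one x) (unitary-one y)))

isBiUnitaryDiv⇒biUnitary : ∀ {n d} → 0 < n → IsBiUnitaryDiv n d → BiUnitary n d
isBiUnitaryDiv⇒biUnitary {n} {d} n>0 (d∣n@(divides e n≡ed) , gcud≡1) =
  e , de≡n , gcud≡1⇒unitarilyCoprime d>0 (divisor-pos (∣-factorʳ d e de≡n) n>0)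
               (subst (λ c → gcud d c ≡ 1) (cof-factor d>0 de≡n) gcud≡1)
  where
  de≡n : d * e ≡ n
  de≡n = trans (*-comm d e) (sym n≡ed)
  d>0 : 0 < d
  d>0 = divisor-pos d∣n n>0

biUnitary⇒isBiUnitaryDiv : ∀ {n d} → 0 < n → BiUnitary n d → IsBiUnitaryDiv n d
biUnitary⇒isBiUnitaryDiv {n} {d} n>0 (e , de≡n , d∥e) =
  d∣n , subst (λ c → gcud d c ≡ 1) (sym (cof-factor d>0 de≡n))
          (unitarilyCoprime⇒gcud≡1 d>0 (divisor-pos (∣-factorʳ d e de≡n) n>0) d∥e)
  where
  d∣n : d ∣ n
  d∣n = ∣-factorˡ d e de≡n
  d>0 : 0 < d
  d>0 = divisor-pos d∣n n>0

∈-unitaryDivisors⁺ : ∀ {n k} → 0 < n → Unitary n k → k ∈ unitaryDivisors n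
∈-unitaryDivisors⁺ n>0 k∥n = ∈-filter-oneTo (isUnitaryDiv? _) n>0 (unitary⇒∣ k∥n) (unitary⇒isUnitaryDiv n>0 k∥n)

∈-unitaryDivisors⁻ : ∀ {n k} → 0 < n → k ∈ unitaryDivisors n → Unitary n k
∈-unitaryDivisors⁻ {n} n>0 k∈ = isUnitaryDiv⇒unitary n>0 (proj₂ (∈-filter⁻ (isUnitaryDiv? n) {xs = oneTo n} k∈))

∈-biUnitaryDivisors⁺ : ∀ {n k} → 0 < n → BiUnitary n k → k ∈ biUnitaryDivisors n
∈-biUnitaryDivisors⁺ n>0 k∥n = ∈-filter-oneTo (isBiUnitaryDiv? _) n>0 (biUnitary⇒∣ k∥n) (biUnitary⇒isBiUnitaryDiv n>0 k∥n)

∈-biUnitaryDivisors⁻ : ∀ {n k} → 0 < n → k ∈ biUnitaryDivisors n → BiUnitary n k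
∈-biUnitaryDivisors⁻ {n} n>0 k∈ = isBiUnitaryDiv⇒biUnitary n>0 (proj₂ (∈-filter⁻ (isBiUnitaryDiv? n) {xs = oneTo n} k∈))

module MultiplicativeCount
  (R : ℕ → ℕ → Set) (L : ℕ → List ℕ)
  (unique : ∀ n → Unique (L n))
  (∈L⁺ : ∀ {n k} → 0 < n → R n k → k ∈ L n)
  (∈L⁻ : ∀ {n k} → 0 < n → k ∈ L n → R n k)
  (R⇒∣ : ∀ {n k} → R n k → k ∣ n)
  (R-split : ∀ {a b k} → Coprime a b → 0 < a → 0 < b → R (a * b) k →
             ∃₂ λ k₁ k₂ → k ≡ k₁ * k₂ × R a k₁ × R b k₂)
  (R-mul : ∀ {a b k₁ k₂} → Coprime a b → 0 < a → 0 < b → R a k₁ → R b k₂ → R (a * b) (k₁ * k₂))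
  where

  length-multiplicative : ∀ {a b} → Coprime a b → 0 < a → 0 < b →
                          length (L (a * b)) ≡ length (L a) * length (L b)
  length-multiplicative {a} {b} a⊥b a>0 b>0 =
    count-products (unique a) (unique b) (unique (a * b))
      (λ k₁∈ k₂∈ → ∈L⁺ ab>0 (R-mul a⊥b a>0 b>0 (∈L⁻ a>0 k₁∈) (∈L⁻ b>0 k₂∈)))
      (λ k∈ → let k₁ , k₂ , k≡ , k₁∥a , k₂∥b = R-split a⊥b a>0 b>0 (∈L⁻ ab>0 k∈) in
              k₁ , k₂ , ∈L⁺ a>0 k₁∥a , ∈L⁺ b>0 k₂∥b , k≡)
      (λ x₁∈ y₁∈ x₂∈ y₂∈ → coprime-factor-unique a⊥b a>0
         (R⇒∣ (∈L⁻ a>0 x₁∈)) (R⇒∣ (∈L⁻ a>0 y₁∈)) (R⇒∣ (∈L⁻ b>0 x₂∈)) (R⇒∣ (∈L⁻ b>0 y₂∈)))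
    where
    ab>0 : 0 < a * b
    ab>0 = *-mono-< a>0 b>0

τ*-multiplicative : ∀ {a b} → Coprime a b → 0 < a → 0 < b → τ* (a * b) ≡ τ* a * τ* b
τ*-multiplicative = MultiplicativeCount.length-multiplicative Unitary unitaryDivisors
  (λ n → unique-filter-oneTo (isUnitaryDiv? n) n) ∈-unitaryDivisors⁺ ∈-unitaryDivisors⁻ unitary⇒∣
  unitary-split (λ a⊥b _ _ → unitary-mul a⊥b)

τ**-multiplicative : ∀ {a b} → Coprime a b → 0 < a → 0 < b → τ** (a * b) ≡ τ** a * τ** b
τ**-multiplicative = MultiplicativeCount.length-multiplicative BiUnitary biUnitaryDivisors
  (λ n → unique-filter-oneTo (isBiUnitaryDiv? n) n) ∈-biUnitaryDivisors⁺ ∈-biUnitaryDivisors⁻ biUnitary⇒∣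
  biUnitary-split biUnitary-mul

τ*-no-proper-unitary : ∀ {n} → 1 < n → (∀ {k} → Unitary n k → k ≡ 1 ⊎ k ≡ n) → τ* n ≡ 2
τ*-no-proper-unitary {n} n>1 trivial =
  unique-length-≡ (unique-filter-oneTo (isUnitaryDiv? n) n) unique-1n listed ⊆listed
  where
  n>0 : 0 < n
  n>0 = <⇒≤ n>1
  unique-1n : Unique (1 ∷ n ∷ [])
  unique-1n = ((λ 1≡n → <-irrefl 1≡n n>1) ∷ []) ∷ [] ∷ []
  listed : unitaryDivisors n ⊆ 1 ∷ n ∷ []
  listed k∈ with trivial (∈-unitaryDivisors⁻ n>0 k∈)
  ... | inj₁ refl = here refl
  ... | inj₂ refl = there (here refl)
  ⊆listed : 1 ∷ n ∷ [] ⊆ unitaryDivisors n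
  ⊆listed (here refl)         = ∈-unitaryDivisors⁺ n>0 (unitary-one n)
  ⊆listed (there (here refl)) = ∈-unitaryDivisors⁺ n>0 (unitary-self n)

-- For n > 1, d ↦ n / d is a fixed-point-free involution of the bi-unitary divisors of n:
-- a fixed point d = n / d is a common unitary divisor of d and n / d, so d = 1 = n / d.
τ**-even : ∀ {n} → 1 < n → 2 ∣ τ** n
τ**-even {n} n>1 = involution-even (cof n) (biUnitaryDivisors n)
  (unique-filter-oneTo (isBiUnitaryDiv? n) n) closed involutive no-fixed-point
  where
  n>0 : 0 < n
  n>0 = <⇒≤ n>1
  cof-complement : ∀ {d} (b : BiUnitary n d) → cof n d ≡ proj₁ b
  cof-complement {d} (e , de≡n , _) = cof-factor (divisor-pos (∣-factorˡ d e de≡n) n>0) de≡n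
  closed : ∀ {d} → d ∈ biUnitaryDivisors n → cof n d ∈ biUnitaryDivisors n
  closed d∈ = let b = ∈-biUnitaryDivisors⁻ n>0 d∈ in
    subst (_∈ biUnitaryDivisors n) (sym (cof-complement b)) (∈-biUnitaryDivisors⁺ n>0 (biUnitary-complement b))
  involutive : ∀ {d} → d ∈ biUnitaryDivisors n → cof n (cof n d) ≡ d
  involutive d∈ = let b = ∈-biUnitaryDivisors⁻ n>0 d∈ in
    trans (cong (cof n) (cof-complement b)) (cof-complement (biUnitary-complement b))
  no-fixed-point : ∀ {d} → d ∈ biUnitaryDivisors n → cof n d ≢ d
  no-fixed-point {d} d∈ cof≡d with ∈-biUnitaryDivisors⁻ n>0 d∈
  ... | b@(e , de≡n , d∥e) with refl ← trans (sym (cof-complement b)) cof≡d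
                           with refl ← d∥e d (unitary-self d) (unitary-self d) = <-irrefl de≡n n>1

Proper : ℕ → ℕ → Set
Proper n u = 1 < u × u < n

proper? : ∀ n → Decidable (Proper n)
proper? n u = (1 <? u) ×-dec (u <? n)

not-between : ∀ {k n} → 0 < k → k ≤ n → ¬ Proper n k → k ≡ 1 ⊎ k ≡ n
not-between {k} {n} k>0 k≤n ¬between with k ≟ n
... | yes k≡n = inj₂ k≡n
... | no k≢n with 1 <? k
...   | yes 1<k = ⊥-elim (¬between (1<k , ≤∧≢⇒< k≤n k≢n))
...   | no 1≮k = inj₁ (≤-antisym (≮⇒≥ 1≮k) k>0)

no-proper-unitary : ∀ {n} → 0 < n → ¬ Any (Proper n) (unitaryDivisors n) →
                    ∀ {k} → Unitary n k → k ≡ 1 ⊎ k ≡ n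
no-proper-unitary n>0 none k∥n =
  not-between (divisor-pos (unitary⇒∣ k∥n) n>0) (divisor-≤ n>0 (unitary⇒∣ k∥n))
              (λ proper → none (lose (∈-unitaryDivisors⁺ n>0 k∥n) proper))

-- Inductive step for τ*(n) ∣ τ**(n), n > 1. If n has a unitary divisor u with 1 < u < n,
-- then n = u · e with u ⊥ e both smaller than n, and both counts are multiplicative;
-- otherwise τ*(n) = 2 while τ**(n) is even.
τ*∣τ**-step : ∀ {n} → 1 < n → (∀ {m} → m < n → 0 < m → τ* m ∣ τ** m) → τ* n ∣ τ** n
τ*∣τ**-step {n} n>1 ih with any? (proper? n) (unitaryDivisors n)
... | yes proper with u , u∈ , 1<u , u<n ← find proper
                 with e , ue≡n , u⊥e ← ∈-unitaryDivisors⁻ (<⇒≤ n>1) u∈ =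
  subst (λ m → τ* m ∣ τ** m) ue≡n
    (subst₂ _∣_ (sym (τ*-multiplicative u⊥e u>0 e>0)) (sym (τ**-multiplicative u⊥e u>0 e>0))
      (*-pres-∣ (ih u<n u>0) (ih e<n e>0)))
  where
  n>0 : 0 < n
  n>0 = <⇒≤ n>1
  u>0 : 0 < u
  u>0 = <⇒≤ 1<u
  e>0 : 0 < e
  e>0 = divisor-pos (∣-factorʳ u e ue≡n) n>0
  e<n : e < n
  e<n = subst (e <_) (trans (*-comm e u) ue≡n) (m<m*n e u {{>-nonZero e>0}} 1<u)
... | no none =
  subst (_∣ τ** n) (sym (τ*-no-proper-unitary n>1 (no-proper-unitary (<⇒≤ n>1) none))) (τ**-even n>1)

τ*∣τ** : ∀ n → 0 < n → τ* n ∣ τ** n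
τ*∣τ** = <-rec (λ n → 0 < n → τ* n ∣ τ** n) step
  where
  step : ∀ n → (∀ {m} → m < n → 0 < m → τ* m ∣ τ** m) → 0 < n → τ* n ∣ τ** n
  step n ih n>0 with n ≟ 1
  ... | yes refl = ∣-refl
  ... | no n≢1   = τ*∣τ**-step (≤∧≢⇒< n>0 (≢-sym n≢1)) ih

prime>1 : ∀ {p} → Prime p → 1 < p
prime>1 {p} p-prime = nonTrivial⇒n>1 p {{prime⇒nonTrivial p-prime}}

prime-power>0 : ∀ {p} → Prime p → ∀ a → 0 < p ^ a
prime-power>0 {p} p-prime a = m^n>0 p {{prime⇒nonZero p-prime}} a

-- Every divisor of p^a is a power of p: peel off a factor p when p divides it, otherwise
-- it is coprime to p and divides p^(a-1).
∣-prime-power : ∀ {p} → Prime p → ∀ a {x} → x ∣ p ^ a → ∃ λ j → x ≡ p ^ j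
∣-prime-power p-prime zero    x∣1 = 0 , ∣1⇒≡1 x∣1
∣-prime-power {p} p-prime (suc a) {x} x∣ with p ∣? x
... | yes (divides q refl) =
  let q∣pᵃ = *-cancelʳ-∣ {q} {p ^ a} p {{prime⇒nonZero p-prime}} (subst (q * p ∣_) (*-comm p (p ^ a)) x∣)
      j , q≡pʲ = ∣-prime-power p-prime a q∣pᵃ
  in suc j , trans (cong (_* p) q≡pʲ) (*-comm (p ^ j) p)
... | no p∤x = ∣-prime-power p-prime a (coprime-divisor x⊥p x∣)
  where
  x⊥p : Coprime x p
  x⊥p {i} (i∣x , i∣p) with prime⇒irreducible p-prime i∣p
  ... | inj₁ i≡1 = i≡1
  ... | inj₂ refl = ⊥-elim (p∤x i∣x)

^-injective : ∀ {p} → Prime p → ∀ {i j} → p ^ i ≡ p ^ j → i ≡ j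
^-injective {p} p-prime {i} {j} eq with <-cmp i j
... | tri< i<j _ _ = ⊥-elim (<-irrefl eq (^-monoʳ-< p (prime>1 p-prime) i<j))
... | tri≈ _ i≡j _ = i≡j
... | tri> _ _ i>j = ⊥-elim (<-irrefl (sym eq) (^-monoʳ-< p (prime>1 p-prime) i>j))

∣-positive-power : ∀ p j → p ∣ p ^ suc j
∣-positive-power p j = m∣m*n (p ^ j)

exponents-add : ∀ {p} → Prime p → ∀ i l {a} → p ^ i * p ^ l ≡ p ^ a → i + l ≡ a
exponents-add {p} p-prime i l eq = ^-injective p-prime (trans (^-distribˡ-+-* p i l) eq)

-- A unitary divisor k of a divisor m of p^a is 1 or m: k and its cofactor are powers of p
-- that cannot both be divisible by p.
unitary-prime-power : ∀ {p} → Prime p → ∀ {a m k} → m ∣ p ^ a → Unitary m k → k ≡ 1 ⊎ k ≡ m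
unitary-prime-power {p} p-prime {a} {m} {k} m∣ (e , ke≡m , k⊥e)
  with ∣-prime-power p-prime a (∣-trans (∣-factorˡ k e ke≡m) m∣)
     | ∣-prime-power p-prime a (∣-trans (∣-factorʳ k e ke≡m) m∣)
... | zero  , k≡1 | _            = inj₁ k≡1
... | suc _ , _   | zero  , refl = inj₂ (trans (sym (*-identityʳ k)) ke≡m)
... | suc i , refl | suc l , refl =
  ⊥-elim (<-irrefl (sym (k⊥e (∣-positive-power p i , ∣-positive-power p l))) (prime>1 p-prime))

-- Unequal complementary divisors of a prime power are unitarily coprime: a common unitary
-- divisor other than 1 would have to equal both of them.
unequal-unitarilyCoprime : ∀ {p} → Prime p → ∀ {a d e} → d * e ≡ p ^ a → d ≢ e → UnitarilyCoprime d e
unequal-unitarilyCoprime p-prime {a} {d} {e} de≡pᵃ d≢e k k∥d k∥e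
  with unitary-prime-power p-prime {a} (∣-factorˡ d e de≡pᵃ) k∥d
     | unitary-prime-power p-prime {a} (∣-factorʳ d e de≡pᵃ) k∥e
... | inj₁ k≡1  | _         = k≡1
... | inj₂ _    | inj₁ k≡1  = k≡1
... | inj₂ refl | inj₂ refl = ⊥-elim (d≢e refl)

even-not-odd : ∀ j → (j + j) % 2 ≢ 1
even-not-odd j odd = 0≢1+n (trans (sym (m*n%n≡0 j 2)) (trans (cong (_% 2) j*2≡j+j) odd))
  where
  j*2≡j+j : j * 2 ≡ j + j
  j*2≡j+j = trans (*-comm j 2) (cong (j +_) (+-identityʳ j))

-- For odd a every divisor of p^a is bi-unitary: d and p^a / d are powers of p whose
-- exponents add up to a, so they cannot be equal.
biUnitary-odd-prime-power : ∀ {p} → Prime p → ∀ {a d} → a % 2 ≡ 1 → d ∣ p ^ a → BiUnitary (p ^ a) d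
biUnitary-odd-prime-power {p} p-prime {a} {d} odd (divides e pᵃ≡ed) =
  e , de≡pᵃ , unequal-unitarilyCoprime p-prime {a} de≡pᵃ d≢e
  where
  de≡pᵃ : d * e ≡ p ^ a
  de≡pᵃ = trans (*-comm d e) (sym pᵃ≡ed)
  d≢e : d ≢ e
  d≢e refl with j , refl ← ∣-prime-power p-prime a (∣-factorˡ d d de≡pᵃ) =
    even-not-odd j (subst (λ c → c % 2 ≡ 1) (sym (exponents-add p-prime j j {a} de≡pᵃ)) odd)

small-prime-power-pair : ∀ {p} → Prime p → ∀ {a d e} → a ≤ 2 → d * e ≡ p ^ a → d ≡ 1 ⊎ e ≡ 1 ⊎ d ≡ e
small-prime-power-pair {p} p-prime {a} {d} {e} a≤2 de≡pᵃ
  with ∣-prime-power p-prime a (∣-factorˡ d e de≡pᵃ) | ∣-prime-power p-prime a (∣-factorʳ d e de≡pᵃ)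
... | i , refl | l , refl = by-exponents i l (subst (_≤ 2) (sym (exponents-add p-prime i l {a} de≡pᵃ)) a≤2)
  where
  by-exponents : ∀ i l → i + l ≤ 2 → p ^ i ≡ 1 ⊎ p ^ l ≡ 1 ⊎ p ^ i ≡ p ^ l
  by-exponents zero          l             _ = inj₁ refl
  by-exponents (suc i)       zero          _ = inj₂ (inj₁ refl)
  by-exponents (suc zero)    (suc zero)    _ = inj₂ (inj₂ refl)
  by-exponents (suc zero)    (suc (suc l)) (s≤s (s≤s ()))
  by-exponents (suc (suc i)) (suc l)       (s≤s (s≤s i+1+l≤0)) with () ← m+n≤o⇒n≤o i i+1+l≤0

trivial-pair-unitary : ∀ {x d e} → d * e ≡ x → d ≡ 1 ⊎ e ≡ 1 → Unitary x d
trivial-pair-unitary de≡x (inj₁ refl) = _ , de≡x , λ (i∣1 , _) → ∣1⇒≡1 i∣1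
trivial-pair-unitary de≡x (inj₂ refl) = 1 , de≡x , λ (_ , i∣1) → ∣1⇒≡1 i∣1

-- For a ∈ {1, 2} every bi-unitary divisor of p^a is unitary: in the balanced case d = e,
-- d is a common unitary divisor of d and e, hence d = 1.
biUnitary⇒unitary-small-prime-power : ∀ {p} → Prime p → ∀ {a d} → a ≡ 1 ⊎ a ≡ 2 →
                                     BiUnitary (p ^ a) d → Unitary (p ^ a) d
biUnitary⇒unitary-small-prime-power p-prime {a} {d} a∈12 (e , de≡pᵃ , d∥e) =
  trivial-pair-unitary de≡pᵃ (trivial-or-balanced (small-prime-power-pair p-prime {a} (≤2 a∈12) de≡pᵃ))
  where
  ≤2 : ∀ {a} → a ≡ 1 ⊎ a ≡ 2 → a ≤ 2
  ≤2 (inj₁ refl) = s≤s z≤n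
  ≤2 (inj₂ refl) = ≤-refl
  trivial-or-balanced : d ≡ 1 ⊎ e ≡ 1 ⊎ d ≡ e → d ≡ 1 ⊎ e ≡ 1
  trivial-or-balanced (inj₁ d≡1)        = inj₁ d≡1
  trivial-or-balanced (inj₂ (inj₁ e≡1)) = inj₂ e≡1
  trivial-or-balanced (inj₂ (inj₂ refl)) = inj₁ (d∥e d (unitary-self d) (unitary-self d))

expand : List (ℕ × ℕ) → ℕ
expand fs = product (map (λ pe → proj₁ pe ^ proj₂ pe) fs)

expand>0 : ∀ fs → All (λ pe → Prime (proj₁ pe)) fs → 0 < expand fs
expand>0 []             []                  = z<s
expand>0 ((p , a) ∷ fs) (p-prime ∷ primes) = *-mono-< (prime-power>0 p-prime a) (expand>0 fs primes)

prime-∣-prime-power : ∀ {p q} → Prime p → Prime q → ∀ b → p ∣ q ^ b → p ≡ q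
prime-∣-prime-power {p} {q} p-prime q-prime b p∣qᵇ with ∣-prime-power q-prime b p∣qᵇ
... | zero  , p≡1 = ⊥-elim (<-irrefl (sym p≡1) (prime>1 p-prime))
... | suc j , p≡qʲ⁺¹ with prime⇒irreducible p-prime (subst (q ∣_) (sym p≡qʲ⁺¹) (∣-positive-power q j))
...   | inj₁ q≡1 = ⊥-elim (<-irrefl (sym q≡1) (prime>1 q-prime))
...   | inj₂ q≡p = sym q≡p

prime-∤-expand : ∀ {p} → Prime p → ∀ fs → All (λ pe → Prime (proj₁ pe)) fs →
                 All (p ≢_) (map proj₁ fs) → ¬ p ∣ expand fs
prime-∤-expand p-prime [] [] [] p∣1 = <-irrefl (sym (∣1⇒≡1 p∣1)) (prime>1 p-prime)
prime-∤-expand p-prime ((q , b) ∷ fs) (q-prime ∷ primes) (p≢q ∷ p∉fs) p∣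
  with euclidsLemma (q ^ b) (expand fs) p-prime p∣
... | inj₁ p∣qᵇ   = p≢q (prime-∣-prime-power p-prime q-prime b p∣qᵇ)
... | inj₂ p∣rest = prime-∤-expand p-prime fs primes p∉fs p∣rest

prime-power-coprime : ∀ {p} → Prime p → ∀ a {m} → ¬ p ∣ m → Coprime (p ^ a) m
prime-power-coprime p-prime a p∤m (i∣pᵃ , i∣m) with ∣-prime-power p-prime a i∣pᵃ
... | zero  , i≡1  = i≡1
... | suc j , refl = ⊥-elim (p∤m (∣-trans (∣-positive-power _ j) i∣m))

expand-head-coprime : ∀ {p a fs} → All (λ pe → Prime (proj₁ pe)) ((p , a) ∷ fs) →
                      Unique (map proj₁ ((p , a) ∷ fs)) → Coprime (p ^ a) (expand fs)
expand-head-coprime {a = a} {fs} (p-prime ∷ primes) (p∉fs ∷ _) =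
  prime-power-coprime p-prime a (prime-∤-expand p-prime fs primes p∉fs)

module LocalToGlobal
  (S T : ℕ → ℕ → Set)
  (S-split : ∀ {a b d} → Coprime a b → 0 < a → 0 < b → S (a * b) d →
             ∃₂ λ d₁ d₂ → d ≡ d₁ * d₂ × S a d₁ × S b d₂)
  (T-mul : ∀ {a b d₁ d₂} → Coprime a b → 0 < a → 0 < b → T a d₁ → T b d₂ → T (a * b) (d₁ * d₂))
  (S-one : ∀ {d} → S 1 d → d ≡ 1) (T-one : T 1 1)
  (E : ℕ → Set) (local : ∀ {p} → Prime p → ∀ {a d} → E a → S (p ^ a) d → T (p ^ a) d)
  where

  global : ∀ fs → All (λ pe → Prime (proj₁ pe)) fs → Unique (map proj₁ fs) →
           All (λ pe → E (proj₂ pe)) fs → ∀ {d} → S (expand fs) d → T (expand fs) d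
  global [] _ _ _ S1d with refl ← S-one S1d = T-one
  global ((p , a) ∷ fs) primes@(p-prime ∷ primes′) distinct@(_ ∷ distinct′) (Ea ∷ Efs) Sd
    with d₁ , d₂ , refl , Sd₁ , Sd₂ ← S-split (expand-head-coprime primes distinct)
                                         (prime-power>0 p-prime a) (expand>0 fs primes′) Sd =
    T-mul (expand-head-coprime primes distinct) (prime-power>0 p-prime a) (expand>0 fs primes′)
          (local p-prime Ea Sd₁) (global fs primes′ distinct′ Efs Sd₂)

∣⇒biUnitary-odd-exponents : ∀ fs → All (λ pe → Prime (proj₁ pe)) fs → Unique (map proj₁ fs) →
  All (λ pe → proj₂ pe % 2 ≡ 1) fs → ∀ {d} → d ∣ expand fs → BiUnitary (expand fs) d
∣⇒biUnitary-odd-exponents = LocalToGlobal.global (λ n d → d ∣ n) BiUnitary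
  (λ a⊥b a>0 _ → coprime-split-divisor a⊥b a>0) biUnitary-mul ∣1⇒≡1 (unitary⇒biUnitary (unitary-one 1))
  (λ a → a % 2 ≡ 1) biUnitary-odd-prime-power

biUnitary⇒unitary-small-exponents : ∀ fs → All (λ pe → Prime (proj₁ pe)) fs → Unique (map proj₁ fs) →
  All (λ pe → proj₂ pe ≡ 1 ⊎ proj₂ pe ≡ 2) fs → ∀ {d} → BiUnitary (expand fs) d → Unitary (expand fs) d
biUnitary⇒unitary-small-exponents = LocalToGlobal.global BiUnitary Unitary
  biUnitary-split (λ a⊥b _ _ → unitary-mul a⊥b) (∣1⇒≡1 ∘ biUnitary⇒∣) (unitary-one 1)
  (λ a → a ≡ 1 ⊎ a ≡ 2) biUnitary⇒unitary-small-prime-power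

biUnitaryDivisors≡unitaryDivisors : ∀ {n} → 0 < n → ExponentsOneOrTwo n →
                                    biUnitaryDivisors n ≡ unitaryDivisors n
biUnitaryDivisors≡unitaryDivisors {n} n>0 (fs , (primes , distinct , n≡) , small) =
  filter-≐ (isBiUnitaryDiv? n) (isUnitaryDiv? n) (biUnitary⇒unitary′ , unitary⇒biUnitary′) (oneTo n)
  where
  biUnitary⇒unitary′ : ∀ {d} → IsBiUnitaryDiv n d → IsUnitaryDiv n d
  biUnitary⇒unitary′ {d} isBi = unitary⇒isUnitaryDiv n>0 (subst (λ m → Unitary m d) (sym n≡)
    (biUnitary⇒unitary-small-exponents fs primes distinct small
      (subst (λ m → BiUnitary m d) n≡ (isBiUnitaryDiv⇒biUnitary n>0 isBi))))
  unitary⇒biUnitary′ : ∀ {d} → IsUnitaryDiv n d → IsBiUnitaryDiv n d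
  unitary⇒biUnitary′ isU = biUnitary⇒isBiUnitaryDiv n>0 (unitary⇒biUnitary (isUnitaryDiv⇒unitary n>0 isU))

biUnitaryDivisors≡divisors : ∀ {n} → 0 < n → ExponentsOdd n → biUnitaryDivisors n ≡ divisors n
biUnitaryDivisors≡divisors {n} n>0 (fs , (primes , distinct , n≡) , odd) =
  filter-≐ (isBiUnitaryDiv? n) (_∣? n) (proj₁ , ∣⇒biUnitary′) (oneTo n)
  where
  ∣⇒biUnitary′ : ∀ {d} → d ∣ n → IsBiUnitaryDiv n d
  ∣⇒biUnitary′ {d} d∣n = biUnitary⇒isBiUnitaryDiv n>0 (subst (λ m → BiUnitary m d) (sym n≡)
    (∣⇒biUnitary-odd-exponents fs primes distinct odd (subst (d ∣_) n≡ d∣n)))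

∣-cong : ∀ {a a′ b b′ : ℕ} → a ≡ a′ → b ≡ b′ → (a ∣ b) ⇔ (a′ ∣ b′)
∣-cong refl refl = mk⇔ (λ h → h) (λ h → h)

-- Since n τ*(n) divides n τ**(n), replacing τ* by τ** in the numerator keeps integrality.
τ*-to-τ**-implications : ∀ {n} → 0 < n →
  (H₂-number n → H₄-number n) × (H*-number n → H₆-number n) × (H₅-number n → H**-number n)
τ*-to-τ**-implications {n} n>0 = raise , raise , raise
  where
  raise : ∀ {m} → m ∣ n * τ* n → m ∣ n * τ** n
  raise m∣ = ∣-trans m∣ (*-monoʳ-∣ n (τ*∣τ** n n>0))

-- With all exponents 1 or 2, σ** = σ* and τ** = τ*.
one-or-two-equivalences : ∀ {n} → 0 < n → ExponentsOneOrTwo n →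
  (H**-number n ⇔ H*-number n) × (H*-number n ⇔ H₆-number n) ×
  (H₅-number n ⇔ H*-number n) × (H₂-number n ⇔ H₄-number n)
one-or-two-equivalences {n} n>0 E =
  ∣-cong σ**≡σ* (cong (n *_) τ**≡τ*) , ∣-cong refl (cong (n *_) (sym τ**≡τ*)) ,
  ∣-cong σ**≡σ* refl , ∣-cong refl (cong (n *_) (sym τ**≡τ*))
  where
  σ**≡σ* : σ** n ≡ σ* n
  σ**≡σ* = cong sum (biUnitaryDivisors≡unitaryDivisors n>0 E)
  τ**≡τ* : τ** n ≡ τ* n
  τ**≡τ* = cong length (biUnitaryDivisors≡unitaryDivisors n>0 E)

-- With all exponents odd, σ** = σ and τ** = τ.
odd-equivalences : ∀ {n} → 0 < n → ExponentsOdd n →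
  (H₂-number n ⇔ H₅-number n) × (H-number n ⇔ H₃-number n) ×
  (H₃-number n ⇔ H₄-number n) × (H₁-number n ⇔ H₆-number n)
odd-equivalences {n} n>0 E =
  ∣-cong (sym σ**≡σ) refl , ∣-cong (sym σ**≡σ) refl ,
  ∣-cong σ**≡σ (cong (n *_) (sym τ**≡τ)) , ∣-cong refl (cong (n *_) (sym τ**≡τ))
  where
  σ**≡σ : σ** n ≡ σ n
  σ**≡σ = cong sum (biUnitaryDivisors≡divisors n>0 E)
  τ**≡τ : τ** n ≡ τ n
  τ**≡τ = cong length (biUnitaryDivisors≡divisors n>0 E)

mainTheorem11 : (n : ℕ) → 0 < n →
    ((H₂-number n → H₄-number n) ×
     (H*-number n → H₆-number n) ×
     (H₅-number n → H**-number n)) ×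
    (ExponentsOneOrTwo n →
      (H**-number n ⇔ H*-number n) ×
      (H*-number n ⇔ H₆-number n) ×
      (H₅-number n ⇔ H*-number n) ×
      (H₂-number n ⇔ H₄-number n)) ×
    (ExponentsOdd n →
      (H₂-number n ⇔ H₅-number n) ×
      (H-number n ⇔ H₃-number n) ×
      (H₃-number n ⇔ H₄-number n) ×
      (H₁-number n ⇔ H₆-number n))
mainTheorem11 n n>0 = τ*-to-τ**-implications n>0 , one-or-two-equivalences n>0 , odd-equivalences n>0
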